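{- For every formula $\varphi$ of $\mathcal{L}_{\mathsf{C}}$, $\vdash_{\mathsf{C}}\varphi\leftrightarrow\varphi^*$.
   Context: $\mathcal{L}_{\mathsf{C}}$: formulae $\varphi::=p\mid\neg\varphi\mid(\varphi\to\varphi)\mid\mathsf{C}\varphi$ over a countably infinite set $\mathit{PROP}$ of proposition symbols; $\wedge,\vee,\leftrightarrow$ usual abbreviations, $\top:=p\vee\neg p$. $\mathit{AX}(\mathcal{L}_{\mathsf{C}})$ (derivability $\vdash_{\mathsf{C}}$): axiom schemata: a complete set of axioms for classical propositional logic; $\mathsf{C}\top$; $\mathsf{C}\varphi\leftrightarrow\mathsf{C}\neg\varphi$; $\mathsf{C}(\varphi\wedge\mathsf{C}\varphi)$; $\mathsf{C}\varphi\wedge\mathsf{C}\psi\to\mathsf{C}(\varphi\wedge\psi)$; $\varphi\wedge\mathsf{C}\varphi\wedge\mathsf{C}(\varphi\to\psi)\to\mathsf{C}\psi$. Rules: Modus Ponens; if $\vdash\varphi\leftrightarrow\psi$ then $\vdash\mathsf{C}\varphi\leftrightarrow\mathsf{C}\psi$. The translation $\varphi\mapsto\varphi^*$ of $\mathcal{L}_{\mathsf{C}}$ into itself: $p^*=p$; $(\neg\varphi)^*=\neg\varphi^*$; $(\varphi\to\psi)^*=(\varphi^*\to\psi^*)$; $(\mathsf{C}\varphi)^*=(\varphi^*\wedge\mathsf{C}\varphi^*)\vee(\neg\varphi^*\wedge\mathsf{C}\neg\varphi^*)$. -}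

module Defs where

open import Data.Nat using (ℕ)

data Form : Set where
  var  : ℕ → Form
  ¬′_  : Form → Form
  _⇒_  : Form → Form → Form
  C    : Form → Form

infixr 6 ¬′_
infixr 4 _⇒_
infixl 5 _∧′_
infixl 5 _∨′_
infix 3 _⇔_

_∨′_ : Form → Form → Form
φ ∨′ ψ = (¬′ φ) ⇒ ψ

_∧′_ : Form → Form → Form
φ ∧′ ψ = ¬′ (φ ⇒ ¬′ ψ)

_⇔_ : Form → Form → Form
φ ⇔ ψ = (φ ⇒ ψ) ∧′ (ψ ⇒ φ)

⊤′ : Form
⊤′ = var 0 ∨′ ¬′ var 0

-- Derivability in AX(L_C).  The classical propositional part is the
-- (complete) Łukasiewicz/Mendelson axiom system A1–A3 with Modus Ponens.
data ⊢_ : Form → Set where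
  ax1 : ∀ φ ψ → ⊢ (φ ⇒ (ψ ⇒ φ))
  ax2 : ∀ φ ψ χ → ⊢ ((φ ⇒ (ψ ⇒ χ)) ⇒ ((φ ⇒ ψ) ⇒ (φ ⇒ χ)))
  ax3 : ∀ φ ψ → ⊢ ((¬′ ψ ⇒ ¬′ φ) ⇒ (φ ⇒ ψ))
  cTop  : ⊢ C ⊤′
  cNeg  : ∀ φ → ⊢ (C φ ⇔ C (¬′ φ))
  cIdem : ∀ φ → ⊢ C (φ ∧′ C φ)
  cConj : ∀ φ ψ → ⊢ (C φ ∧′ C ψ ⇒ C (φ ∧′ ψ))
  cImp  : ∀ φ ψ → ⊢ (φ ∧′ C φ ∧′ C (φ ⇒ ψ) ⇒ C ψ)
  mp    : ∀ {φ ψ} → ⊢ (φ ⇒ ψ) → ⊢ φ → ⊢ ψ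
  re    : ∀ {φ ψ} → ⊢ (φ ⇔ ψ) → ⊢ (C φ ⇔ C ψ)

infix 2 ⊢_

_* : Form → Form
var p *   = var p
(¬′ φ) *  = ¬′ (φ *)
(φ ⇒ ψ) * = (φ *) ⇒ (ψ *)
C φ *     = ((φ *) ∧′ C (φ *)) ∨′ ((¬′ (φ *)) ∧′ C (¬′ (φ *)))

-- For Cφ, the
-- replacement rule gives Cφ ↔ Cφ*, and since Cφ* ↔ C¬φ* is an axiom, the
-- case split (φ* ∧ Cφ*) ∨ (¬φ* ∧ C¬φ*) is equivalent to Cφ* by propositional
-- reasoning alone. Every propositional step is an instance of a tautology, and
-- tautologies are derivable by Kalmár's completeness argument.
module Submission where

open import Defs
open import Data.Bool using (Bool; true; false; not; T; _∧_)
open import Data.Bool.Properties using (T-∧)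
open import Data.Fin using (Fin; zero; suc; #_)
open import Data.List using (List; []; _∷_)
open import Data.List.Membership.Propositional using (_∈_)
open import Data.List.Relation.Unary.Any using (here; there)
open import Data.Nat using (ℕ)
open import Data.Product using (proj₁; proj₂)
open import Data.Unit using (tt)
open import Data.Vec using (Vec; []; _∷_; lookup)
open import Function using (_∘_)
open import Function.Bundles using (Equivalence)
open import Relation.Binary.PropositionalEquality using (refl)

infix 2 _⊩_

data _⊩_ (Γ : List Form) : Form → Set where
  hyp : ∀ {φ} → φ ∈ Γ → Γ ⊩ φ
  thm : ∀ {φ} → ⊢ φ → Γ ⊩ φ
  app : ∀ {φ ψ} → Γ ⊩ (φ ⇒ ψ) → Γ ⊩ φ → Γ ⊩ ψ

hyp₀ : ∀ {Γ φ} → φ ∷ Γ ⊩ φ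
hyp₀ = hyp (here refl)

hyp₁ : ∀ {Γ φ ψ} → ψ ∷ φ ∷ Γ ⊩ φ
hyp₁ = hyp (there (here refl))

hyp₂ : ∀ {Γ φ ψ χ} → χ ∷ ψ ∷ φ ∷ Γ ⊩ φ
hyp₂ = hyp (there (there (here refl)))

⇒-refl : ∀ φ → ⊢ (φ ⇒ φ)
⇒-refl φ = mp (mp (ax2 φ (φ ⇒ φ) φ) (ax1 φ (φ ⇒ φ))) (ax1 φ φ)

deduction : ∀ {Γ φ ψ} → φ ∷ Γ ⊩ ψ → Γ ⊩ (φ ⇒ ψ)
deduction (hyp (here refl)) = thm (⇒-refl _)
deduction (hyp (there φ∈Γ)) = app (thm (ax1 _ _)) (hyp φ∈Γ)
deduction (thm ⊢φ)          = app (thm (ax1 _ _)) (thm ⊢φ)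
deduction (app d e)         = app (app (thm (ax2 _ _ _)) (deduction d)) (deduction e)

close : ∀ {φ} → [] ⊩ φ → ⊢ φ
close (thm ⊢φ)  = ⊢φ
close (app d e) = mp (close d) (close e)

¬¬-elim : ∀ φ → ⊢ (¬′ ¬′ φ ⇒ φ)
¬¬-elim φ = close (deduction
  (app (app (thm (ax3 (¬′ ¬′ φ) φ))
            (app (thm (ax3 (¬′ φ) (¬′ ¬′ ¬′ φ))) (app (thm (ax1 _ _)) hyp₀)))
       hyp₀))

¬¬-intro : ∀ φ → ⊢ (φ ⇒ ¬′ ¬′ φ)
¬¬-intro φ = mp (ax3 φ (¬′ ¬′ φ)) (¬¬-elim (¬′ φ))

ex-falso : ∀ φ ψ → ⊢ (¬′ φ ⇒ φ ⇒ ψ)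
ex-falso φ ψ = close (deduction (deduction
  (app (app (thm (ax3 φ ψ)) (app (thm (ax1 (¬′ φ) (¬′ ψ))) hyp₁)) hyp₀)))

contraposition : ∀ φ ψ → ⊢ ((φ ⇒ ψ) ⇒ (¬′ ψ ⇒ ¬′ φ))
contraposition φ ψ = close (deduction (app (thm (ax3 (¬′ ψ) (¬′ φ)))
  (deduction (app (thm (¬¬-intro ψ)) (app hyp₁ (app (thm (¬¬-elim φ)) hyp₀))))))

⇒-refute : ∀ φ ψ → ⊢ (φ ⇒ ¬′ ψ ⇒ ¬′ (φ ⇒ ψ))
⇒-refute φ ψ = close (deduction
  (app (thm (contraposition (φ ⇒ ψ) ψ)) (deduction (app hyp₀ hyp₁))))

-- From φ → ψ and ¬φ → ψ, a contradiction is derivable under ¬ψ; ax3 turns it into ψ.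
by-cases : ∀ φ ψ → ⊢ ((φ ⇒ ψ) ⇒ (¬′ φ ⇒ ψ) ⇒ ψ)
by-cases φ ψ = close (deduction (deduction
  (app (app (thm (ax3 (ψ ⇒ ψ) ψ)) (deduction
         (app (app (thm (ex-falso (¬′ φ) (¬′ (ψ ⇒ ψ))))
                   (app (app (thm (contraposition (¬′ φ) ψ)) hyp₁) hyp₀))
              (app (app (thm (contraposition φ ψ)) hyp₂) hyp₀))))
       (thm (⇒-refl ψ)))))

infixr 6 ¬ₛ_
infixr 4 _⇒ₛ_
infixl 5 _∧ₛ_ _∨ₛ_
infix 3 _⇔ₛ_

data Schema (n : ℕ) : Set where
  atom : Fin n → Schema n
  ¬ₛ_  : Schema n → Schema n
  _⇒ₛ_ : Schema n → Schema n → Schema n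

_∧ₛ_ _∨ₛ_ _⇔ₛ_ : ∀ {n} → Schema n → Schema n → Schema n
s ∧ₛ t = ¬ₛ (s ⇒ₛ ¬ₛ t)
s ∨ₛ t = ¬ₛ s ⇒ₛ t
s ⇔ₛ t = (s ⇒ₛ t) ∧ₛ (t ⇒ₛ s)

⟦_⟧ : ∀ {n} → Schema n → Vec Form n → Form
⟦ atom i ⟧ σ = lookup σ i
⟦ ¬ₛ s ⟧ σ   = ¬′ ⟦ s ⟧ σ
⟦ s ⇒ₛ t ⟧ σ = ⟦ s ⟧ σ ⇒ ⟦ t ⟧ σ

_⇒ᵇ_ : Bool → Bool → Bool
true  ⇒ᵇ b = b
false ⇒ᵇ _ = true

eval : ∀ {n} → Vec Bool n → Schema n → Bool
eval v (atom i) = lookup v i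
eval v (¬ₛ s)   = not (eval v s)
eval v (s ⇒ₛ t) = eval v s ⇒ᵇ eval v t

literal : Bool → Form → Form
literal true  φ = φ
literal false φ = ¬′ φ

literals : ∀ {n} → Vec Form n → Vec Bool n → List Form
literals []      []      = []
literals (φ ∷ σ) (b ∷ v) = literal b φ ∷ literals σ v

literal∈literals : ∀ {n} (σ : Vec Form n) v i → literal (lookup v i) (lookup σ i) ∈ literals σ v
literal∈literals (φ ∷ σ) (b ∷ v) zero    = here refl
literal∈literals (φ ∷ σ) (b ∷ v) (suc i) = there (literal∈literals σ v i)

kalmar : ∀ {n} (s : Schema n) σ v → literals σ v ⊩ literal (eval v s) (⟦ s ⟧ σ)
kalmar (atom i) σ v = hyp (literal∈literals σ v i)
kalmar (¬ₛ s) σ v with eval v s | kalmar s σ v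
... | true  | d = app (thm (¬¬-intro _)) d
... | false | d = d
kalmar (s ⇒ₛ t) σ v with eval v s | kalmar s σ v | eval v t | kalmar t σ v
... | false | ds | _     | _  = app (thm (ex-falso _ _)) ds
... | true  | _  | true  | dt = app (thm (ax1 _ _)) dt
... | true  | ds | false | dt = app (app (thm (⇒-refute _ _)) ds) dt

eliminate-literals : ∀ {n ψ} (σ : Vec Form n) → (∀ v → literals σ v ⊩ ψ) → [] ⊩ ψ
eliminate-literals []      d = d []
eliminate-literals (φ ∷ σ) d = eliminate-literals σ λ v →
  app (app (thm (by-cases φ _)) (deduction (d (true ∷ v)))) (deduction (d (false ∷ v)))

literal-true : ∀ {Γ b φ} → T b → Γ ⊩ literal b φ → Γ ⊩ φ
literal-true {b = true} _ d = d

Tautology : ∀ {n} → Schema n → Set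
Tautology s = ∀ v → T (eval v s)

tautology-derivable : ∀ {n} (s : Schema n) → Tautology s → ∀ σ → ⊢ ⟦ s ⟧ σ
tautology-derivable s taut σ =
  close (eliminate-literals σ λ v → literal-true (taut v) (kalmar s σ v))

all-valuations : ∀ {n} → (Vec Bool n → Bool) → Bool
all-valuations {ℕ.zero}  f = f []
all-valuations {ℕ.suc n} f = all-valuations (f ∘ (true ∷_)) ∧ all-valuations (f ∘ (false ∷_))

all-valuations-sound : ∀ {n} (f : Vec Bool n → Bool) → T (all-valuations f) → ∀ v → T (f v)
all-valuations-sound f h []          = h
all-valuations-sound f h (true ∷ v)  = all-valuations-sound _ (proj₁ (Equivalence.to T-∧ h)) v
all-valuations-sound f h (false ∷ v) = all-valuations-sound _ (proj₂ (Equivalence.to T-∧ h)) v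

-- Closed schemata make the side condition compute to ⊤, so it is discharged by tt.
tautology-instance : ∀ {n} (s : Schema n) → T (all-valuations (λ v → eval v s)) → ∀ σ → ⊢ ⟦ s ⟧ σ
tautology-instance s check = tautology-derivable s (all-valuations-sound _ check)

⇔-refl : ∀ φ → ⊢ φ ⇔ φ
⇔-refl φ = tautology-instance (p ⇔ₛ p) tt (φ ∷ [])
  where p = atom (# 0)

⇔-cong-¬ : ∀ {φ ψ} → ⊢ φ ⇔ ψ → ⊢ ¬′ φ ⇔ ¬′ ψ
⇔-cong-¬ {φ} {ψ} = mp (tautology-instance ((p ⇔ₛ q) ⇒ₛ (¬ₛ p ⇔ₛ ¬ₛ q)) tt (φ ∷ ψ ∷ []))
  where p = atom (# 0); q = atom (# 1)

⇔-cong-⇒ : ∀ {φ φ′ ψ ψ′} → ⊢ φ ⇔ φ′ → ⊢ ψ ⇔ ψ′ → ⊢ (φ ⇒ ψ) ⇔ (φ′ ⇒ ψ′)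
⇔-cong-⇒ {φ} {φ′} {ψ} {ψ′} φ⇔φ′ ψ⇔ψ′ =
  mp (mp (tautology-instance taut tt (φ ∷ φ′ ∷ ψ ∷ ψ′ ∷ [])) φ⇔φ′) ψ⇔ψ′
  where
  p = atom (# 0); p′ = atom (# 1); q = atom (# 2); q′ = atom (# 3)
  taut = (p ⇔ₛ p′) ⇒ₛ (q ⇔ₛ q′) ⇒ₛ ((p ⇒ₛ q) ⇔ₛ (p′ ⇒ₛ q′))

⇔-by-cases : ∀ {φ ψ χ} δ → ⊢ φ ⇔ ψ → ⊢ ψ ⇔ χ → ⊢ φ ⇔ (δ ∧′ ψ) ∨′ (¬′ δ ∧′ χ)
⇔-by-cases {φ} {ψ} {χ} δ φ⇔ψ ψ⇔χ =
  mp (mp (tautology-instance taut tt (φ ∷ ψ ∷ χ ∷ δ ∷ [])) φ⇔ψ) ψ⇔χ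
  where
  p = atom (# 0); q = atom (# 1); r = atom (# 2); d = atom (# 3)
  taut = (p ⇔ₛ q) ⇒ₛ (q ⇔ₛ r) ⇒ₛ (p ⇔ₛ (d ∧ₛ q) ∨ₛ (¬ₛ d ∧ₛ r))

lemma7p3 : (φ : Form) → ⊢ (φ ⇔ φ *)
lemma7p3 (var i) = ⇔-refl (var i)
lemma7p3 (¬′ φ)  = ⇔-cong-¬ (lemma7p3 φ)
lemma7p3 (φ ⇒ ψ) = ⇔-cong-⇒ (lemma7p3 φ) (lemma7p3 ψ)
lemma7p3 (C φ)   = ⇔-by-cases (φ *) (re (lemma7p3 φ)) (cNeg (φ *))
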